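{- Let $n,x\in\mathbb{N}$ be such that $\hat F_n(x,k)>0$ for some integer $k\ge 0$. Then the smallest integer $k$ with $\hat F_n(x,k)>0$ is $\left\lfloor \frac{n}{n-x+1}\right\rfloor$.
   Context: For integers $n,x,k\ge 0$, $\hat B_n^{x,k}$ denotes the set of palindromic binary strings (strings equal to their reversal) of length $n$ that contain exactly $x$ zeros and in which the longest block of consecutive zeros has length exactly $k$. $\hat F_n(x,k)=|\hat B_n^{x,k}|$. -}

module Defs where

open import Data.Bool using (Bool; true; false; _∧_; if_then_else_)
open import Data.Nat using (ℕ; zero; suc; _+_; _⊔_; _≡ᵇ_)
open import Data.List using (List; []; _∷_; map; _++_; length; filterᵇ; reverse)
open import Data.Vec using (Vec; []; _∷_; toList)

-- Binary strings of length n are  Vec Bool n ; the letter 0 is  false , 1 is  true .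

allStrings : (n : ℕ) → List (Vec Bool n)
allStrings zero    = [] ∷ []
allStrings (suc n) = map (false ∷_) (allStrings n) ++ map (true ∷_) (allStrings n)

eqBits : List Bool → List Bool → Bool
eqBits [] [] = true
eqBits (true ∷ xs) (true ∷ ys) = eqBits xs ys
eqBits (false ∷ xs) (false ∷ ys) = eqBits xs ys
eqBits _ _ = false

isPalindrome : List Bool → Bool
isPalindrome w = eqBits w (reverse w)

zeros : List Bool → ℕ
zeros [] = 0
zeros (false ∷ w) = suc (zeros w)
zeros (true ∷ w) = zeros w

-- longest block of consecutive zeros; cur = length of the current zero run
longestAux : ℕ → List Bool → ℕ
longestAux cur [] = cur
longestAux cur (false ∷ w) = longestAux (suc cur) w
longestAux cur (true ∷ w) = cur ⊔ longestAux 0 w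

longestZeroRun : List Bool → ℕ
longestZeroRun = longestAux 0

inB : (n x k : ℕ) → Vec Bool n → Bool
inB n x k v = isPalindrome (toList v) ∧ (zeros (toList v) ≡ᵇ x) ∧ (longestZeroRun (toList v) ≡ᵇ k)

F̂ : ℕ → ℕ → ℕ → ℕ
F̂ n x k = length (filterᵇ (inB n x k) (allStrings n))

-- Write m = n ∸ x for the number of ones and q = ⌊n / (m+1)⌋.
--
-- The m ones cut any string into m+1 zero blocks, so a string
-- whose longest zero run is L has at most (m+1)·L zeros.  Hence n = x + m is
-- smaller than (m+1)·(L+1), i.e. q ≤ L.  This holds for every string.
--
-- Conversely x ≤ (m+1)·q.  A palindrome with x zeros and m ones
-- whose runs are all ≤ q is built from the outside in: peel off two mirrored
-- outer blocks of a ≤ q zeros (each followed/preceded by a one) and recurse on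
-- m-2 ones and x-2a zeros; the centre is a single block (m = 0) or two equal
-- blocks around a one (m = 1), in which case x must be even.  That parity
-- condition is supplied by the given palindrome: in a palindrome the number of
-- zeros or the number of ones is even.  By the lower bound, the constructed
-- palindrome has longest run exactly q.

module Submission where

open import Defs
open import Data.Nat using (ℕ; suc; _+_; _∸_; _<_; _≤_)
open import Data.Nat.DivMod using (_/_)
open import Data.Product using (_×_; ∃-syntax)

open import Data.Nat using (zero; _*_; _⊔_; _≡ᵇ_; z≤n; s≤s; s≤s⁻¹; _≤?_)
open import Data.Nat.Properties
open import Data.Nat.DivMod using (_%_; m≡m%n+[m/n]*n; m%n<n; m<n*o⇒m/o<n)
open import Data.Nat.Tactic.RingSolver using (solve-∀)
open import Data.Bool using (Bool; true; false; _∧_; T)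
open import Data.Bool.Properties using (T-∧)
open import Data.List using (List; []; _∷_; map; _++_; length; reverse; replicate; _∷ʳ_)
open import Data.List.Properties
  using (++-assoc; ++-identityʳ; unfold-reverse; reverse-++; ∷-injective; ∷ʳ-injectiveˡ; length-++-≤ˡ; filter-some)
open import Data.List.Reverse using (reverseView; []; _∶_∶ʳ_)
open import Data.List.Relation.Unary.Any using (here)
open import Data.List.Membership.Propositional using (_∈_; lose)
open import Data.List.Membership.Propositional.Properties using (∈-map⁺; ∈-++⁺ˡ; ∈-++⁺ʳ; ∈-filter⁻)
open import Data.Vec using (Vec; toList; fromList)
open import Data.Vec.Properties using (toList∘fromList; length-toList)
open import Data.Product using (Σ; _,_)
open import Data.Sum using (_⊎_; inj₁; inj₂)
import Data.Sum as Sum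
open import Data.Empty using (⊥; ⊥-elim)
open import Function using (_∘_)
open import Function.Bundles using (Equivalence)
open import Relation.Nullary using (yes; no; ¬_)
open import Relation.Nullary.Decidable using (T?)
open import Relation.Binary.PropositionalEquality

rep : ℕ → List Bool
rep a = replicate a false

ones : List Bool → ℕ
ones [] = 0
ones (false ∷ w) = ones w
ones (true ∷ w) = suc (ones w)

length-split : ∀ w → length w ≡ zeros w + ones w
length-split [] = refl
length-split (false ∷ w) = cong suc (length-split w)
length-split (true ∷ w) = trans (cong suc (length-split w)) (sym (+-suc (zeros w) (ones w)))

zeros-++ : ∀ u v → zeros (u ++ v) ≡ zeros u + zeros v
zeros-++ [] v = refl
zeros-++ (false ∷ u) v = cong suc (zeros-++ u v)
zeros-++ (true ∷ u) v = zeros-++ u v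

ones-++ : ∀ u v → ones (u ++ v) ≡ ones u + ones v
ones-++ [] v = refl
ones-++ (false ∷ u) v = ones-++ u v
ones-++ (true ∷ u) v = cong suc (ones-++ u v)

zeros-rep : ∀ a → zeros (rep a) ≡ a
zeros-rep zero = refl
zeros-rep (suc a) = cong suc (zeros-rep a)

ones-rep : ∀ a → ones (rep a) ≡ 0
ones-rep zero = refl
ones-rep (suc a) = ones-rep a

longestAux-rep : ∀ c a r → longestAux c (rep a ++ r) ≡ longestAux (a + c) r
longestAux-rep c zero r = refl
longestAux-rep c (suc a) r =
  trans (longestAux-rep (suc c) a r) (cong (λ z → longestAux z r) (+-suc a c))

longestAux-join : ∀ c u v → longestAux c (u ++ true ∷ v) ≡ longestAux c u ⊔ longestZeroRun v
longestAux-join c [] v = refl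
longestAux-join c (false ∷ u) v = longestAux-join (suc c) u v
longestAux-join c (true ∷ u) v = trans (cong (c ⊔_) (longestAux-join 0 u v)) (sym (⊔-assoc c _ _))

run-rep : ∀ a → longestZeroRun (rep a) ≡ a
run-rep a = begin
  longestAux 0 (rep a)        ≡⟨ cong (longestAux 0) (sym (++-identityʳ (rep a))) ⟩
  longestAux 0 (rep a ++ [])  ≡⟨ longestAux-rep 0 a [] ⟩
  a + 0                       ≡⟨ +-identityʳ a ⟩
  a                           ∎
  where open ≡-Reasoning

-- Invariant of the scan: a current run c plus the remaining zeros fit into
-- (remaining ones + 1) runs of length at most the final answer.
zeros-≤-runs : ∀ c w → c + zeros w ≤ suc (ones w) * longestAux c w
zeros-≤-runs c [] = ≤-refl
zeros-≤-runs c (false ∷ w) =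
  subst (_≤ suc (ones w) * longestAux (suc c) w) (sym (+-suc c (zeros w))) (zeros-≤-runs (suc c) w)
zeros-≤-runs c (true ∷ w) =
  +-mono-≤ (m≤m⊔n c L) (≤-trans (zeros-≤-runs 0 w) (*-monoʳ-≤ (suc (ones w)) (m≤n⊔m c L)))
  where L = longestZeroRun w

quotient-≤-run : ∀ w → length w / suc (ones w) ≤ longestZeroRun w
quotient-≤-run w = s≤s⁻¹ (m<n*o⇒m/o<n {length w} {suc L} {suc m} length<)
  where
  L = longestZeroRun w
  m = ones w
  length< : length w < suc L * suc m
  length< = begin-strict
    length w           ≡⟨ trans (length-split w) (+-comm (zeros w) m) ⟩
    m + zeros w        <⟨ +-monoˡ-< (zeros w) (n<1+n m) ⟩
    suc m + zeros w    ≤⟨ +-monoʳ-≤ (suc m) (zeros-≤-runs 0 w) ⟩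
    suc m + suc m * L  ≡⟨ cong (suc m +_) (*-comm (suc m) L) ⟩
    suc L * suc m      ∎
    where open ≤-Reasoning

zeros-≤-quotient : ∀ n m x → n ≡ x + m → x ≤ suc m * (n / suc m)
zeros-≤-quotient n m x split = +-cancelʳ-≤ m x _ (begin
    x + m                            ≡⟨ sym split ⟩
    n                                ≡⟨ m≡m%n+[m/n]*n n (suc m) ⟩
    n % suc m + (n / suc m) * suc m  ≤⟨ +-monoˡ-≤ _ (s≤s⁻¹ (m%n<n n (suc m))) ⟩
    m + (n / suc m) * suc m          ≡⟨ +-comm m _ ⟩
    (n / suc m) * suc m + m          ≡⟨ cong (_+ m) (*-comm (n / suc m) (suc m)) ⟩
    suc m * (n / suc m) + m          ∎)
  where open ≤-Reasoning

Ev : ℕ → Set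
Ev n = Σ ℕ λ h → n ≡ h + h

-- A palindrome with one 1 must have evenly many zeros; this rules out the other case.
¬Ev1 : Ev 1 → ⊥
¬Ev1 (zero , ())
¬Ev1 (suc h , e) with trans (suc-injective e) (+-suc h h)
... | ()

Ev-cancel : ∀ a {r} → Ev ((a + a) + r) → Ev r
Ev-cancel zero e = e
Ev-cancel (suc a) (zero , ())
Ev-cancel (suc a) {r} (suc h , e) = Ev-cancel a (h , suc-injective (begin
  suc ((a + a) + r)    ≡⟨ cong (_+ r) (+-suc a a) ⟨
  (a + suc a) + r      ≡⟨ suc-injective e ⟩
  h + suc h            ≡⟨ +-suc h h ⟩
  suc (h + h)          ∎))
  where open ≡-Reasoning

half : ∀ x → Σ ℕ λ h → Σ ℕ λ b → b ≤ 1 × x ≡ (h + h) + b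
half zero = 0 , 0 , z≤n , refl
half (suc zero) = 0 , 1 , s≤s z≤n , refl
half (suc (suc x)) with half x
... | h , b , b≤1 , e = suc h , b , b≤1 , cong suc (trans (cong suc e) (cong (_+ b) (sym (+-suc h h))))

double-≤-cancel : ∀ a b → a + a ≤ b + b → a ≤ b
double-≤-cancel a b le with a ≤? b
... | yes a≤b = a≤b
... | no a≰b = ⊥-elim (<⇒≱ (+-mono-< (≰⇒> a≰b) (≰⇒> a≰b)) le)

Ev-mirror : (f : List Bool → ℕ) → (∀ u v → f (u ++ v) ≡ f u + f v) →
  ∀ a t → Ev (f t) → Ev (f (a ∷ t ∷ʳ a))
Ev-mirror f f-++ a t (h , e) = f (a ∷ []) + h , (begin
  f ((a ∷ []) ++ (t ++ a ∷ []))   ≡⟨ f-++ (a ∷ []) (t ++ a ∷ []) ⟩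
  c + f (t ++ a ∷ [])             ≡⟨ cong (c +_) (f-++ t (a ∷ [])) ⟩
  c + (f t + c)                   ≡⟨ cong (λ z → c + (z + c)) e ⟩
  c + ((h + h) + c)               ≡⟨ rearrange c h ⟩
  (c + h) + (c + h)               ∎)
  where
  open ≡-Reasoning
  c = f (a ∷ [])
  rearrange : ∀ c h → c + ((h + h) + c) ≡ (c + h) + (c + h)
  rearrange = solve-∀

peel-palindrome : ∀ {A : Set} (a : A) t b → reverse (a ∷ t ∷ʳ b) ≡ a ∷ t ∷ʳ b →
  a ≡ b × reverse t ≡ t
peel-palindrome a t b pal with ∷-injective (trans (sym unfolded) pal)
  where
  unfolded : reverse (a ∷ t ∷ʳ b) ≡ b ∷ (reverse t ∷ʳ a)
  unfolded = trans (unfold-reverse a (t ∷ʳ b)) (cong (_∷ʳ a) (reverse-++ t (b ∷ [])))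
... | b≡a , inside = sym b≡a , ∷ʳ-injectiveˡ (reverse t) t inside

-- In a palindrome the zeros or the ones are even in number (the middle letter,
-- if any, is the only unpaired one).  Recursion on a length bound, since two
-- letters are removed at a time.
palindrome-parity-within : ∀ k w → length w ≤ k → reverse w ≡ w → Ev (zeros w) ⊎ Ev (ones w)
palindrome-parity-within k [] _ _ = inj₁ (0 , refl)
palindrome-parity-within zero (_ ∷ _) () _
palindrome-parity-within (suc k) (a ∷ t) (s≤s len) pal with reverseView t
palindrome-parity-within (suc k) (false ∷ .[]) _ _ | [] = inj₂ (0 , refl)
palindrome-parity-within (suc k) (true ∷ .[]) _ _ | [] = inj₁ (0 , refl)
palindrome-parity-within (suc k) (a ∷ .(t ∷ʳ b)) (s≤s len) pal | t ∶ _ ∶ʳ b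
  with peel-palindrome a t b pal
... | refl , inside =
  Sum.map (Ev-mirror zeros zeros-++ a t) (Ev-mirror ones ones-++ a t)
    (palindrome-parity-within k t (≤-trans (length-++-≤ˡ t) len) inside)

palindrome-parity : ∀ w → reverse w ≡ w → Ev (zeros w) ⊎ Ev (ones w)
palindrome-parity w = palindrome-parity-within (length w) w ≤-refl

Shape : ℕ → ℕ → ℕ → List Bool → Set
Shape q x m w = zeros w ≡ x × ones w ≡ m × longestZeroRun w ≤ q

shape-rep : ∀ {q a} → a ≤ q → Shape q a 0 (rep a)
shape-rep {a = a} a≤q = zeros-rep a , ones-rep a , ≤-trans (≤-reflexive (run-rep a)) a≤q

shape-join : ∀ {q x y m k} u v → Shape q x m u → Shape q y k v →
  Shape q (x + y) (m + suc k) (u ++ true ∷ v)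
shape-join u v (zu , ou , ru) (zv , ov , rv) =
  trans (zeros-++ u (true ∷ v)) (cong₂ _+_ zu zv) ,
  trans (ones-++ u (true ∷ v)) (cong₂ (λ s t → s + suc t) ou ov) ,
  subst (_≤ _) (sym (longestAux-join 0 u v)) (⊔-lub ru rv)

reverse-join : ∀ {A : Set} (u : List A) x v → reverse (u ++ x ∷ v) ≡ reverse v ++ x ∷ reverse u
reverse-join u x v = trans (reverse-++ u (x ∷ v))
  (trans (cong (_++ reverse u) (unfold-reverse x v)) (++-assoc (reverse v) (x ∷ []) (reverse u)))

reverse-rep : ∀ a → reverse (rep a) ≡ rep a
reverse-rep zero = refl
reverse-rep (suc a) = trans (unfold-reverse false (rep a))
  (trans (cong (_∷ʳ false) (reverse-rep a)) (rep-snoc a))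
  where
  rep-snoc : ∀ a → rep a ∷ʳ false ≡ false ∷ rep a
  rep-snoc zero = refl
  rep-snoc (suc a) = cong (false ∷_) (rep-snoc a)

-- Two blocks of h zeros around a one: the centre of a palindrome with an odd number of ones.
centre : ℕ → List Bool
centre h = rep h ++ true ∷ rep h

reverse-centre : ∀ h → reverse (centre h) ≡ centre h
reverse-centre h = trans (reverse-join (rep h) true (rep h))
  (cong₂ (λ s t → s ++ true ∷ t) (reverse-rep h) (reverse-rep h))

mirror : ℕ → List Bool → List Bool
mirror a s = rep a ++ true ∷ (s ++ true ∷ rep a)

reverse-mirror : ∀ a {s} → reverse s ≡ s → reverse (mirror a s) ≡ mirror a s
reverse-mirror a {s} pal = begin
  reverse (rep a ++ true ∷ (s ++ true ∷ rep a))
    ≡⟨ reverse-join (rep a) true (s ++ true ∷ rep a) ⟩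
  reverse (s ++ true ∷ rep a) ++ true ∷ reverse (rep a)
    ≡⟨ cong₂ (λ l r → l ++ true ∷ r) (reverse-join s true (rep a)) (reverse-rep a) ⟩
  (reverse (rep a) ++ true ∷ reverse s) ++ true ∷ rep a
    ≡⟨ cong₂ (λ l r → (l ++ true ∷ r) ++ true ∷ rep a) (reverse-rep a) pal ⟩
  (rep a ++ true ∷ s) ++ true ∷ rep a
    ≡⟨ ++-assoc (rep a) (true ∷ s) (true ∷ rep a) ⟩
  rep a ++ true ∷ (s ++ true ∷ rep a)
    ∎
  where open ≡-Reasoning

shape-mirror : ∀ {q a x m s} → a ≤ q → Shape q x m s → Shape q ((a + a) + x) (suc (suc m)) (mirror a s)
shape-mirror {q} {a} {x} {m} {s} a≤q shape =
  subst₂ (λ y k → Shape q y k (mirror a s)) (zeros-count a x) (ones-count m)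
    (shape-join (rep a) (s ++ true ∷ rep a) (shape-rep a≤q) (shape-join s (rep a) shape (shape-rep a≤q)))
  where
  zeros-count : ∀ a x → a + (x + a) ≡ (a + a) + x
  zeros-count = solve-∀
  ones-count : ∀ m → 0 + suc (m + suc 0) ≡ suc (suc m)
  ones-count = solve-∀

-- Arithmetic of one construction step: x zeros that fit into m+3 blocks of
-- size ≤ q split as two outer blocks a ≤ q and a remainder fitting m+1 blocks.
peel-blocks : ∀ q m x → x ≤ suc (suc (suc m)) * q →
  Σ ℕ λ a → Σ ℕ λ r → a ≤ q × x ≡ (a + a) + r × r ≤ suc m * q
peel-blocks q m x bound with (q + q) ≤? x
... | yes 2q≤x = q , x ∸ (q + q) , ≤-refl , sym (m+[n∸m]≡n 2q≤x) ,
  +-cancelˡ-≤ (q + q) _ _ (subst₂ _≤_ (sym (m+[n∸m]≡n 2q≤x)) (outer-blocks m q) bound)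
  where
  outer-blocks : ∀ m q → suc (suc (suc m)) * q ≡ (q + q) + suc m * q
  outer-blocks = solve-∀
... | no 2q≰x with half x
...   | h , b , b≤1 , x≡ = h , b , h≤q , x≡ , m≤n⇒m≤o*n (suc m) (≤-trans b≤1 (1≤q q 2q≰x))
  where
  h≤q : h ≤ q
  h≤q = double-≤-cancel h q
    (≤-trans (≤-trans (m≤m+n (h + h) b) (≤-reflexive (sym x≡))) (<⇒≤ (≰⇒> 2q≰x)))
  1≤q : ∀ q → ¬ (q + q ≤ x) → 1 ≤ q
  1≤q zero 0≰x = ⊥-elim (0≰x z≤n)
  1≤q (suc q) _ = s≤s z≤n

Realises : ℕ → ℕ → ℕ → List Bool → Set
Realises q x m w = reverse w ≡ w × Shape q x m w

realisable : ∀ q m x → x ≤ suc m * q → Ev x ⊎ Ev m → Σ (List Bool) (Realises q x m)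
realisable q zero x bound _ = rep x , reverse-rep x , shape-rep (subst (x ≤_) (+-identityʳ q) bound)
realisable q (suc zero) x bound (inj₂ ev1) = ⊥-elim (¬Ev1 ev1)
realisable q (suc zero) .(h + h) bound (inj₁ (h , refl)) =
  centre h , reverse-centre h , shape-join (rep h) (rep h) (shape-rep h≤q) (shape-rep h≤q)
  where
  h≤q : h ≤ q
  h≤q = double-≤-cancel h q (subst (h + h ≤_) (cong (q +_) (+-identityʳ q)) bound)
realisable q (suc (suc m)) x bound parity with peel-blocks q m x bound
... | a , r , a≤q , refl , r≤ with realisable q m r r≤ (Sum.map (Ev-cancel a) (Ev-cancel 1) parity)
...   | s , pal , shape = mirror a s , reverse-mirror a pal , shape-mirror a≤q shape

Good : ℕ → ℕ → ℕ → List Bool → Set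
Good n x k w = length w ≡ n × reverse w ≡ w × zeros w ≡ x × longestZeroRun w ≡ k

accepts : ℕ → ℕ → List Bool → Bool
accepts x k w = isPalindrome w ∧ (zeros w ≡ᵇ x) ∧ (longestZeroRun w ≡ᵇ k)

eqBits-sound : ∀ u v → T (eqBits u v) → u ≡ v
eqBits-sound [] [] _ = refl
eqBits-sound (true ∷ u) (true ∷ v) e = cong (true ∷_) (eqBits-sound u v e)
eqBits-sound (false ∷ u) (false ∷ v) e = cong (false ∷_) (eqBits-sound u v e)
eqBits-sound [] (_ ∷ _) ()
eqBits-sound (true ∷ u) [] ()
eqBits-sound (false ∷ u) [] ()
eqBits-sound (true ∷ u) (false ∷ v) ()
eqBits-sound (false ∷ u) (true ∷ v) ()

eqBits-refl : ∀ w → T (eqBits w w)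
eqBits-refl [] = _
eqBits-refl (true ∷ w) = eqBits-refl w
eqBits-refl (false ∷ w) = eqBits-refl w

accepts-sound : ∀ x k w → T (accepts x k w) → reverse w ≡ w × zeros w ≡ x × longestZeroRun w ≡ k
accepts-sound x k w t with Equivalence.to T-∧ t
... | pal , rest with Equivalence.to T-∧ rest
...   | z , l = sym (eqBits-sound w (reverse w) pal) , ≡ᵇ⇒≡ _ x z , ≡ᵇ⇒≡ _ k l

accepts-complete : ∀ w → reverse w ≡ w → T (accepts (zeros w) (longestZeroRun w) w)
accepts-complete w pal = Equivalence.from T-∧
  (subst (T ∘ eqBits w) (sym pal) (eqBits-refl w) ,
   Equivalence.from T-∧ (≡⇒≡ᵇ (zeros w) _ refl , ≡⇒≡ᵇ (longestZeroRun w) _ refl))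

all-strings-complete : ∀ n (v : Vec Bool n) → v ∈ allStrings n
all-strings-complete zero Vec.[] = here refl
all-strings-complete (suc n) (false Vec.∷ v) = ∈-++⁺ˡ (∈-map⁺ (false Vec.∷_) (all-strings-complete n v))
all-strings-complete (suc n) (true Vec.∷ v) =
  ∈-++⁺ʳ (map (false Vec.∷_) (allStrings n)) (∈-map⁺ (true Vec.∷_) (all-strings-complete n v))

nonempty-member : ∀ {A : Set} (xs : List A) → 0 < length xs → Σ A (_∈ xs)
nonempty-member (v ∷ _) _ = v , here refl

extract : ∀ {n x k} → 0 < F̂ n x k → Σ (List Bool) (Good n x k)
extract {n} {x} {k} pos with nonempty-member _ pos
... | v , v∈ with ∈-filter⁻ (T? ∘ inB n x k) {xs = allStrings n} v∈
...   | _ , accepted = toList v , length-toList v , accepts-sound x k (toList v) accepted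

build : ∀ {n x k w} → Good n x k w → 0 < F̂ n x k
build {w = w} (refl , pal , refl , refl) =
  filter-some (T? ∘ inB (length w) _ _)
    (lose (all-strings-complete _ (fromList w))
      (subst (T ∘ accepts _ _) (sym (toList∘fromList w)) (accepts-complete w pal)))

good-ones : ∀ {n x k w} → Good n x k w → ones w ≡ n ∸ x
good-ones {x = x} {w = w} (len , _ , zw , _) =
  sym (trans (cong (_∸ x) (trans (sym len) (trans (length-split w) (cong (_+ ones w) zw))))
             (m+n∸m≡n x (ones w)))

good-split : ∀ {n x k w} → Good n x k w → n ≡ x + (n ∸ x)
good-split {x = x} {w = w} good@(len , _ , zw , _) =
  trans (sym len) (trans (length-split w) (cong₂ _+_ zw (good-ones good)))

good-quotient-≤ : ∀ {n x k w} → Good n x k w → n / suc (n ∸ x) ≤ k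
good-quotient-≤ {w = w} good@(len , _ , _ , run) =
  subst₂ (λ l o → l / suc o ≤ _) len (good-ones good) (subst (_ ≤_) run (quotient-≤-run w))

realised-good : ∀ {n x m w} → n ≡ x + m → Realises (n / suc m) x m w → Good n x (n / suc m) w
realised-good {n} {w = w} split (pal , zw , ow , run≤) =
  len , pal , zw , ≤-antisym run≤ (subst₂ (λ l o → l / suc o ≤ _) len ow (quotient-≤-run w))
  where
  len : length w ≡ n
  len = trans (length-split w) (trans (cong₂ _+_ zw ow) (sym split))

corollary5p3 : (n x : ℕ) → (∃[ k ] 0 < F̂ n x k) →
    (0 < F̂ n x (n / (suc (n ∸ x)))) × (∀ k → 0 < F̂ n x k → n / (suc (n ∸ x)) ≤ k)
corollary5p3 n x (k , pos) = attained , minimal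
  where
  minimal : ∀ k → 0 < F̂ n x k → n / suc (n ∸ x) ≤ k
  minimal k pos with extract {n} {x} pos
  ... | _ , good = good-quotient-≤ {n} {x} good

  m = n ∸ x
  attained : 0 < F̂ n x (n / suc m)
  attained with extract {n} {x} {k} pos
  ... | w₀ , good₀@(_ , pal₀ , zw₀ , _) with
        realisable (n / suc m) m x (zeros-≤-quotient n m x (good-split good₀))
          (subst₂ (λ z o → Ev z ⊎ Ev o) zw₀ (good-ones good₀) (palindrome-parity w₀ pal₀))
  ...   | _ , realised = build {n} {x} (realised-good (good-split good₀) realised)
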